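{- Assume the setting described in the context, and suppose $b_s'=1$. Let $j\in X$ and let $S\in\mathcal{B}(c_s')$ with $j\in S$. Then \begin{enumerate} \item the set of edges between $B_j$ and $\Delta_j$ is a matching, \item the set of edges between $B_j(S)$ and $\Delta(S)$ is a matching, \item $\{B_j(S')\mid S'\in\mathcal{B}(c_s'),\ j\in S'\}$ is a partition of $B_j$, and \item $\{\Delta(S')\mid S'\in\mathcal{B}(c_s'),\ j\in S'\}$ is a partition of $\Delta_j$. \end{enumerate}
   Context: Graphs are finite, simple, connected, undirected. For a vertex $v$, $\Gamma_i(v)$ is the set of vertices at distance $i$ from $v$. The $v$-girth $\lambda_v(\Gamma)$ is the length of a shortest cycle through $v$; the local girth at $\alpha$ is $\lambda(\Gamma,\alpha)=\min(\{\lambda_\alpha(\Gamma)\}\cup\{\lambda_\beta(\Gamma)+1\mid\beta\in\Gamma_1(\alpha)\})$. A group acting on a set $Y$ is $t$-homogeneous if it is transitive on the $t$-subsets of $Y$. Setting: $\Gamma$ is a $k$-regular graph with $k\geqslant 3$, $G\leqslant\mathrm{Aut}(\Gamma)$, $\alpha\in V\Gamma$, $s\geqslant1$ with $\lambda(\Gamma,\alpha)\geqslant 2s+2$, $G_\alpha$ is transitive on $\Gamma_s(\alpha)$, and $\Delta$ is a $G_\alpha$-orbit contained in $\Gamma_{s+1}(\alpha)$. Let $c_s'=|\Gamma_1(\delta)\cap\Gamma_s(\alpha)|$ for $\delta\in\Delta$ and $b_s'=|\Gamma_1(\gamma)\cap\Delta|$ for $\gamma\in\Gamma_s(\alpha)$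 (these do not depend on $\delta$, $\gamma$). Assume the action of $G_\alpha$ on $\Gamma_1(\alpha)$ is $t$-homogeneous for some integer $1\leqslant t\leqslant c_s'$. Write $\Gamma_1(\alpha)=\{\beta_1,\ldots,\beta_k\}$, $X=\{1,\ldots,k\}$. For $j\in X$ let $B_j=\Gamma_s(\alpha)\cap\Gamma_{s-1}(\beta_j)$ and $\Delta_j=\Delta\cap\Gamma_s(\beta_j)$. For $S\subseteq X$ let $\Delta(S)=\Delta\cap\bigcap_{i\in S}\Gamma_s(\beta_i)$ and $B_j(S)=\bigcup_{\delta\in\Delta(S)}(B_j\cap\Gamma_1(\delta))$, and let $\mathcal{B}(c_s')=\{S\subseteq X\mid |S|=c_s',\ \Delta(S)\neq\emptyset\}$. -}

module Defs where

open import Level using (0ℓ)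
open import Data.Nat using (ℕ; zero; suc; _≤_; _+_; _∸_; _*_)
open import Data.Fin using (Fin)
open import Data.Fin.Subset using (Subset; _∈_; ∣_∣)
open import Data.List using (List; []; _∷_; length; [_]; _++_)
open import Data.List.Relation.Unary.Unique.Propositional using (Unique)
open import Data.List.Relation.Unary.Linked using (Linked)
import Data.List.Membership.Propositional as LM
open import Data.Product using (Σ; ∃; ∃-syntax; _×_; _,_)
open import Data.Sum using (_⊎_)
open import Relation.Binary.PropositionalEquality using (_≡_)
open import Relation.Nullary using (¬_)
open import Function using (_↔_; _⇔_; Injective)
open import Function.Bundles using (Inverse)
open import Function.Construct.Identity using (↔-id)
open import Function.Construct.Composition using (_↔-∘_)
open import Function.Construct.Symmetry using (↔-sym)

record Graph (n : ℕ) : Set₁ where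
  field
    Adj   : Fin n → Fin n → Set
    sym   : ∀ {x y} → Adj x y → Adj y x
    irrefl : ∀ {x} → ¬ Adj x x
open Graph public

module _ {n : ℕ} (Γ : Graph n) where

  data Walk : Fin n → Fin n → ℕ → Set where
    here : ∀ {u} → Walk u u 0
    step : ∀ {u w v d} → Adj Γ u w → Walk w v d → Walk u v (suc d)

  Connected : Set
  Connected = ∀ u v → ∃[ d ] Walk u v d

  Dist : Fin n → Fin n → ℕ → Set
  Dist u v d = Walk u v d × (∀ m → Walk u v m → d ≤ m)

  Sphere : Fin n → ℕ → Fin n → Set
  Sphere v i x = Dist v x i

  CycleThrough : Fin n → ℕ → Set
  CycleThrough v ℓ = Σ (List (Fin n)) λ xs →
    length (v ∷ xs) ≡ ℓ × 3 ≤ ℓ × Unique (v ∷ xs) × Linked (Adj Γ) (v ∷ xs ++ [ v ])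

  -- λ_v(Γ) ≥ m  (every cycle through v has length ≥ m; vacuous if none)
  vGirth≥ : Fin n → ℕ → Set
  vGirth≥ v m = ∀ ℓ → CycleThrough v ℓ → m ≤ ℓ

  -- λ(Γ, α) ≥ m, where λ(Γ,α) = min({λ_α} ∪ {λ_β + 1 | β ∈ Γ₁(α)})
  localGirth≥ : Fin n → ℕ → Set
  localGirth≥ α m = vGirth≥ α m × (∀ β → Adj Γ α β → ∀ ℓ → CycleThrough β ℓ → m ≤ suc ℓ)

  IsAut : (Fin n ↔ Fin n) → Set
  IsAut g = ∀ x y → Adj Γ x y ⇔ Adj Γ (Inverse.to g x) (Inverse.to g y)

  -- the set of edges between A and B is a matching:
  -- any two such edges sharing an endpoint are the same edge
  IsMatching : (Fin n → Set) → (Fin n → Set) → Set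
  IsMatching A B = ∀ x y x′ y′ →
    A x → B y → Adj Γ x y → A x′ → B y′ → Adj Γ x′ y′ →
    (x ≡ x′ ⊎ x ≡ y′ ⊎ y ≡ x′ ⊎ y ≡ y′) →
    (x ≡ x′ × y ≡ y′) ⊎ (x ≡ y′ × y ≡ x′)

HasSize : {n : ℕ} → (Fin n → Set) → ℕ → Set
HasSize {n} P m = Σ (List (Fin n)) λ xs →
  Unique xs × (∀ x → (x LM.∈ xs) ⇔ P x) × length xs ≡ m

record AutSubgroup {n : ℕ} (Γ : Graph n) : Set₁ where
  field
    Mem   : (Fin n ↔ Fin n) → Set
    aut   : ∀ g → Mem g → IsAut Γ g
    id∈   : Mem (↔-id (Fin n))
    comp∈ : ∀ g h → Mem g → Mem h → Mem (g ↔-∘ h)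
    inv∈  : ∀ g → Mem g → Mem (↔-sym g)
open AutSubgroup public

IsPartition : {n : ℕ} {I : Set} → (I → Set) → (I → Fin n → Set) → (Fin n → Set) → Set
IsPartition {n} {I} Idx F Y =
  (∀ i → Idx i → ∃[ y ] F i y) ×
  (∀ i i′ → Idx i → Idx i′ →
     (∀ y → F i y ⇔ F i′ y) ⊎ (∀ y → F i y → F i′ y → Data.Empty.⊥)) ×
  (∀ y → Y y ⇔ (∃[ i ] (Idx i × F i y)))
  where import Data.Empty

record Setting (n k s t c : ℕ) : Set₁ where
  field
    Γ      : Graph n
    conn   : Connected Γ
    regular : ∀ v → HasSize (Adj Γ v) k
    k≥3    : 3 ≤ k
    G      : AutSubgroup Γ
    α      : Fin n
    s≥1    : 1 ≤ s
    girth  : localGirth≥ Γ α (2 * s + 2)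
    trans-s : ∀ x y → Sphere Γ α s x → Sphere Γ α s y →
              ∃[ g ] (Mem G g × Inverse.to g α ≡ α × Inverse.to g x ≡ y)
    Δ      : Fin n → Set
    Δ⊆     : ∀ x → Δ x → Sphere Γ α (suc s) x
    δ₀     : Fin n
    orbit  : ∀ x → Δ x ⇔ (∃[ g ] (Mem G g × Inverse.to g α ≡ α × Inverse.to g δ₀ ≡ x))
    cs′    : ∀ δ → Δ δ → HasSize (λ x → Adj Γ δ x × Sphere Γ α s x) c
    -- enumeration Γ₁(α) = {β₁,…,β_k}, X = Fin k
    β      : Fin k → Fin n
    β-inj  : Injective _≡_ _≡_ β
    β-adj  : ∀ i → Adj Γ α (β i)
    β-onto : ∀ x → Adj Γ α x → ∃[ i ] β i ≡ x
    1≤t    : 1 ≤ t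
    t≤c    : t ≤ c
    homog  : ∀ (T U : Subset k) → ∣ T ∣ ≡ t → ∣ U ∣ ≡ t →
             ∃[ g ] (Mem G g × Inverse.to g α ≡ α ×
               (∀ x → (∃[ i ] (i ∈ T × β i ≡ x)) ⇔
                       (∃[ i ] (i ∈ U × β i ≡ Inverse.to g x))))

module _ {n k s t c : ℕ} (σ : Setting n k s t c) where
  open Setting σ

  bs′≡ : ℕ → Set
  bs′≡ m = ∀ γ → Sphere Γ α s γ → HasSize (λ x → Adj Γ γ x × Δ x) m

  Bj : Fin k → Fin n → Set
  Bj j x = Sphere Γ α s x × Sphere Γ (β j) (s ∸ 1) x

  Δj : Fin k → Fin n → Set
  Δj j x = Δ x × Sphere Γ (β j) s x

  ΔS : Subset k → Fin n → Set
  ΔS S x = Δ x × (∀ i → i ∈ S → Sphere Γ (β i) s x)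

  BjS : Fin k → Subset k → Fin n → Set
  BjS j S x = ∃[ δ ] (ΔS S δ × Bj j x × Adj Γ δ x)

  𝓑 : Subset k → Set
  𝓑 S = ∣ S ∣ ≡ c × ∃[ δ ] ΔS S δ

module Submission where

-- Write s = s' + 1.  The girth bound enters only through `unique-branch`: a
-- vertex at distance m+1 ≤ s from α is at distance m from at most one β_i, as
-- descending walks from two of them would close a cycle through α of length
-- ≤ 2s (`simple-path`).  Hence for δ ∈ Δ the last steps of geodesics from the
-- β_i with δ ∈ Γ_s(β_i) are distinct neighbours of δ in Γ_s(α), so by
-- `pigeonhole` at most c_s' such i exist, and for c_s' of them every neighbour
-- of δ in some B_j is such a last step (`full-size-predecessor`).  As Δ is a
-- G_α-orbit, the given S ∈ 𝓑(c_s') moves to every δ ∈ Δ (`full-index-set`), so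
-- each δ ∈ Δ lies in Δ(S') for exactly one S' ∈ 𝓑(c_s') and has one neighbour
-- in each B_j, j ∈ S'; with b_s' = 1 the four statements follow.

open import Defs
open import Data.Nat using (ℕ; zero; suc; _≤_; _+_; _*_; z≤n; s≤s)
open import Data.Nat.Properties
  using ( ≤-refl; ≤-reflexive; ≤-trans; ≤-antisym; ≤-pred; n≤1+n; 1+n≰n; <-irrefl
        ; +-suc; +-comm; +-cancelʳ-≤; +-monoʳ-≤; +-monoʳ-<; *-monoʳ-<; module ≤-Reasoning)
open import Data.Fin using (Fin; zero; suc)
import Data.Fin.Properties as Fin
open import Data.Fin.Subset using (Subset; _∈_; ∣_∣; inside; outside)
open import Data.Fin.Subset.Properties using (_∈?_; ⊆-antisym)
open import Data.Vec.Base using ([]; _∷_; here; there; tabulate; lookup)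
import Data.Vec.Properties as Vec
import Data.Bool.Properties as Bool
open import Data.List using (List; []; _∷_; length; [_]; _++_; map)
import Data.List.Properties as List
open import Data.List.Relation.Unary.All using (All; []; _∷_)
import Data.List.Relation.Unary.All as All
import Data.List.Relation.Unary.All.Properties as All
open import Data.List.Relation.Unary.AllPairs using ([]; _∷_)
import Data.List.Relation.Unary.AllPairs.Properties as AllPairs
open import Data.List.Relation.Unary.Any using (here; there; _─_; index)
open import Data.List.Relation.Unary.Unique.Propositional using (Unique)
open import Data.List.Relation.Unary.Linked using (Linked; [-]; _∷_)
open import Data.List.Membership.Propositional using () renaming (_∈_ to _∈ₗ_)
open import Data.List.Membership.Propositional.Properties using (∈-map⁺)
open import Data.Product using (Σ; ∃-syntax; _×_; _,_; proj₁; proj₂)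
open import Data.Sum using (_⊎_; inj₁; inj₂)
open import Data.Empty using (⊥; ⊥-elim)
open import Relation.Binary.Definitions using (DecidableEquality)
open import Relation.Binary.PropositionalEquality
  using (_≡_; _≢_; refl; cong; subst; subst₂; ≢-sym)
import Relation.Binary.PropositionalEquality as ≡
open import Relation.Nullary using (¬_; yes; no)
open import Function using (_∘_; _↔_; _⇔_; mk⇔)
open import Function.Bundles using (Inverse; Equivalence)
open import Function.Construct.Composition using (_↔-∘_)
open import Function.Construct.Symmetry using (↔-sym)

size-one-unique : ∀ {n} {P : Fin n → Set} → HasSize P 1 → ∀ {y y′} → P y → P y′ → y ≡ y′
size-one-unique ((z ∷ []) , _ , members , refl) {y} {y′} py py′
  with Equivalence.from (members y) py | Equivalence.from (members y′) py′
... | here y≡z | here y′≡z = ≡.trans y≡z (≡.sym y′≡z)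

size-one-witness : ∀ {n} {P : Fin n → Set} → HasSize P 1 → ∃[ y ] P y
size-one-witness ((z ∷ []) , _ , members , refl) = z , Equivalence.to (members z) (here refl)

equal-or-disjoint : ∀ {I A : Set} → DecidableEquality I → (Idx : I → Set) (F : I → A → Set) →
  (∀ i i′ y → Idx i → Idx i′ → F i y → F i′ y → i ≡ i′) →
  ∀ i i′ → Idx i → Idx i′ → (∀ y → F i y ⇔ F i′ y) ⊎ (∀ y → F i y → F i′ y → ⊥)
equal-or-disjoint _≟_ Idx F meet i i′ idx idx′ with i ≟ i′
... | yes refl = inj₁ λ _ → mk⇔ (λ z → z) (λ z → z)
... | no i≢i′ = inj₂ λ y fy fy′ → i≢i′ (meet i i′ y idx idx′ fy fy′)

module Distances {n : ℕ} (Γ : Graph n) where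

  infix 4 _~_
  _~_ : Fin n → Fin n → Set
  _~_ = Adj Γ

  ~-sym : ∀ {x y} → x ~ y → y ~ x
  ~-sym = sym Γ

  FarFrom : Fin n → Fin n → ℕ → Set
  FarFrom v y d = ∀ m → Walk Γ v y m → d ≤ m

  snoc : ∀ {u v w d} → Walk Γ u v d → v ~ w → Walk Γ u w (suc d)
  snoc here e = step e here
  snoc (step a w) e = step a (snoc w e)

  _++ʷ_ : ∀ {u v w d e} → Walk Γ u v d → Walk Γ v w e → Walk Γ u w (d + e)
  here ++ʷ q = q
  step a p ++ʷ q = step a (p ++ʷ q)

  unsnoc : ∀ {u v d} → Walk Γ u v (suc d) → ∃[ x ] (Walk Γ u x d × x ~ v)
  unsnoc (step a here) = _ , here , a
  unsnoc (step a (step b w)) with unsnoc (step b w)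
  ... | x , w′ , e = x , step a w′ , e

  dist-unique : ∀ {v x i j} → Sphere Γ v i x → Sphere Γ v j x → i ≡ j
  dist-unique x∈Γᵢ x∈Γⱼ = ≤-antisym (proj₂ x∈Γᵢ _ (proj₁ x∈Γⱼ)) (proj₂ x∈Γⱼ _ (proj₁ x∈Γᵢ))

  sphere-zero : ∀ v → Sphere Γ v 0 v
  sphere-zero v = here , λ _ _ → z≤n

  sphere-one : ∀ {u v} → u ~ v → Sphere Γ u 1 v
  sphere-one {u} {v} u~v = step u~v here , far
    where
    far : FarFrom u v 1
    far zero here = ⊥-elim (irrefl Γ u~v)
    far (suc m) _ = s≤s z≤n

  far-step : ∀ {u v y d} → u ~ v → FarFrom u y (suc d) → FarFrom v y d
  far-step u~v far m ω = ≤-pred (far (suc m) (step u~v ω))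

  far-snoc : ∀ {v x y d} → x ~ y → FarFrom v y (suc d) → FarFrom v x d
  far-snoc x~y far m ω = ≤-pred (far (suc m) (snoc ω x~y))

  far-weaken : ∀ {v y d} → FarFrom v y (suc d) → FarFrom v y d
  far-weaken far m ω = ≤-trans (n≤1+n _) (far m ω)

  far-≢ : ∀ {v u y d} → Sphere Γ v d u → FarFrom v y (suc d) → u ≢ y
  far-≢ (w , _) far refl = 1+n≰n (far _ w)

  walk-map : (h : Fin n → Fin n) → (∀ {x y} → x ~ y → h x ~ h y) →
             ∀ {u v d} → Walk Γ u v d → Walk Γ (h u) (h v) d
  walk-map h h-adj here = here
  walk-map h h-adj (step a w) = step (h-adj a) (walk-map h h-adj w)

  module Automorphism (g : Fin n ↔ Fin n) (g-aut : IsAut Γ g) where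
    open Inverse g using (to; from; strictlyInverseˡ; strictlyInverseʳ)

    aut-adj : ∀ {x y} → x ~ y → to x ~ to y
    aut-adj {x} {y} = Equivalence.to (g-aut x y)

    aut⁻¹-adj : ∀ {x y} → x ~ y → from x ~ from y
    aut⁻¹-adj {x} {y} x~y = Equivalence.from (g-aut (from x) (from y))
      (subst₂ _~_ (≡.sym (strictlyInverseˡ x)) (≡.sym (strictlyInverseˡ y)) x~y)

    aut-sphere : ∀ {u d x} → Sphere Γ u d x → Sphere Γ (to u) d (to x)
    aut-sphere {u} {d} {x} (w , far) = walk-map to aut-adj w , λ m ω →
      far m (subst₂ (λ a b → Walk Γ a b m) (strictlyInverseʳ u) (strictlyInverseʳ x)
              (walk-map from aut⁻¹-adj ω))

  matching-mono : ∀ {A B A′ B′ : Fin n → Set} → IsMatching Γ A′ B′ →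
    (∀ x → A x → A′ x) → (∀ y → B y → B′ y) → IsMatching Γ A B
  matching-mono m A⊆ B⊆ x y x′ y′ ax by e ax′ by′ e′ =
    m x y x′ y′ (A⊆ _ ax) (B⊆ _ by) e (A⊆ _ ax′) (B⊆ _ by′) e′

module Descent {n : ℕ} (Γ : Graph n) (α : Fin n) where
  open Distances Γ

  -- a walk of length q from u (at distance p from α) to x along which the
  -- distance from α grows by one at each step
  data Descending : ℕ → Fin n → Fin n → ℕ → Set where
    stop : ∀ {p u} → Descending p u u 0
    down : ∀ {p u w x q} → u ~ w → Sphere Γ α (suc p) w →
           Descending (suc p) w x q → Descending p u x (suc q)

  descending : ∀ {p u x q} → Sphere Γ α p u → Walk Γ u x q → FarFrom α x (p + q) →
               Descending p u x q
  descending u∈Γₚ here _ = stop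
  descending {p} {x = x} {suc q} u∈Γₚ (step {w = w} u~w rest) far =
    down u~w w∈Γₚ₊₁ (descending w∈Γₚ₊₁ rest far′)
    where
    far′ : FarFrom α x (suc p + q)
    far′ m ω = subst (_≤ m) (+-suc p q) (far m ω)
    w∈Γₚ₊₁ : Sphere Γ α (suc p) w
    w∈Γₚ₊₁ = snoc (proj₁ u∈Γₚ) u~w , λ m ω → +-cancelʳ-≤ q (suc p) m (far′ (m + q) (ω ++ʷ rest))

  length-snoc : ∀ (M : List (Fin n)) y → length (M ++ [ y ]) ≡ suc (length M)
  length-snoc [] y = refl
  length-snoc (m ∷ M) y = cong suc (length-snoc M y)

  linked-snoc : ∀ a M b c → Linked _~_ (a ∷ M ++ [ b ]) → b ~ c → Linked _~_ (a ∷ (M ++ [ b ]) ++ [ c ])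
  linked-snoc a [] b c (a~b ∷ [-]) b~c = a~b ∷ b~c ∷ [-]
  linked-snoc a (m ∷ M) b c (a~m ∷ rest) b~c = a~m ∷ linked-snoc m M b c rest b~c

  SimplePath : ℕ → ℕ → Fin n → Fin n → Set
  SimplePath p q u v = Σ (List (Fin n)) λ M →
    Linked _~_ (u ∷ M ++ [ v ]) × Unique (u ∷ M ++ [ v ]) ×
    All (λ y → FarFrom α y p) (u ∷ M ++ [ v ]) × suc (length M) ≤ 2 * q

  -- two descending walks of the same length from distinct vertices to a common
  -- end yield a simple path between their starting points: follow both walks
  -- until they first meet
  simple-path : ∀ {p q u v x} → u ≢ v → Sphere Γ α p u → Sphere Γ α p v →
                Descending p u x q → Descending p v x q → SimplePath p q u v
  simple-path u≢v _ _ stop stop = ⊥-elim (u≢v refl)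
  simple-path {p} {suc q} {u} {v} u≢v u∈Γₚ v∈Γₚ (down {w = u₁} u~u₁ u₁∈Γ du) (down {w = v₁} v~v₁ v₁∈Γ dv)
    with u₁ Fin.≟ v₁
  ... | yes refl =
        [ u₁ ] , u~u₁ ∷ ~-sym v~v₁ ∷ [-] ,
        ((far-≢ u∈Γₚ u₁-far ∷ u≢v ∷ []) ∷ (≢-sym (far-≢ v∈Γₚ u₁-far) ∷ []) ∷ [] ∷ []) ,
        (proj₂ u∈Γₚ ∷ far-weaken u₁-far ∷ proj₂ v∈Γₚ ∷ []) ,
        s≤s (subst (1 ≤_) (≡.sym (+-suc q (q + 0))) (s≤s z≤n))
    where
    u₁-far : FarFrom α u₁ (suc p)
    u₁-far = proj₂ u₁∈Γ
  ... | no u₁≢v₁ with simple-path u₁≢v₁ u₁∈Γ v₁∈Γ du dv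
  ...   | M , linked , unique , far , len =
        (u₁ ∷ M ++ [ v₁ ]) , (u~u₁ ∷ linked-snoc u₁ M v₁ v linked (~-sym v~v₁)) ,
        (All.++⁺ (All.map (far-≢ u∈Γₚ) far) (u≢v ∷ []) ∷
           AllPairs.++⁺ unique ([] ∷ []) (All.map (λ y-far → ≢-sym (far-≢ v∈Γₚ y-far) ∷ []) far)) ,
        (proj₂ u∈Γₚ ∷ All.++⁺ (All.map far-weaken far) (proj₂ v∈Γₚ ∷ [])) ,
        len′
    where
    len′ : suc (length (u₁ ∷ M ++ [ v₁ ])) ≤ 2 * suc q
    len′ rewrite length-snoc M v₁ | +-suc q (q + 0) = s≤s (s≤s len)

module SubsetPigeonhole where

  InjectiveOn : ∀ {k} {A : Set} → Subset k → (Fin k → A) → Set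
  InjectiveOn U f = ∀ i j → i ∈ U → j ∈ U → f i ≡ f j → i ≡ j

  ∈-─ : ∀ {A : Set} {xs : List A} {x z} → z ∈ₗ xs → z ≢ x → (p : x ∈ₗ xs) → z ∈ₗ (xs ─ p)
  ∈-─ (here refl) z≢x (here refl) = ⊥-elim (z≢x refl)
  ∈-─ (here z≡y) _ (there _) = here z≡y
  ∈-─ (there z∈) _ (here _) = z∈
  ∈-─ (there z∈) z≢x (there p) = there (∈-─ z∈ z≢x p)

  pigeonhole : ∀ {k} {A : Set} (U : Subset k) (L : List A) (f : Fin k → A) →
               InjectiveOn U f → (∀ i → i ∈ U → f i ∈ₗ L) → ∣ U ∣ ≤ length L
  pigeonhole [] L f inj into = z≤n
  pigeonhole (outside ∷ U) L f inj into =
    pigeonhole U L (f ∘ suc) (λ i j p q e → Fin.suc-injective (inj _ _ (there p) (there q) e))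
      (λ i p → into _ (there p))
  pigeonhole (inside ∷ U) L f inj into =
    subst (suc ∣ U ∣ ≤_) (≡.sym (List.length-removeAt′ L (index f₀∈L)))
      (s≤s (pigeonhole U (L ─ f₀∈L) (f ∘ suc)
        (λ i j p q e → Fin.suc-injective (inj _ _ (there p) (there q) e))
        (λ i p → ∈-─ (into (suc i) (there p))
                   (λ e → Fin.0≢1+n (≡.sym (inj _ _ (there p) here e))) f₀∈L)))
    where
    f₀∈L : f zero ∈ₗ L
    f₀∈L = into zero here

  pigeonhole-strict : ∀ {k} {A : Set} (U : Subset k) (L : List A) (f : Fin k → A) →
    InjectiveOn U f → (∀ i → i ∈ U → f i ∈ₗ L) →
    ∀ e → e ∈ₗ L → (∀ i → i ∈ U → e ≢ f i) → suc ∣ U ∣ ≤ length L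
  pigeonhole-strict U L f inj into e e∈L missed =
    subst (suc ∣ U ∣ ≤_) (≡.sym (List.length-removeAt′ L (index e∈L)))
      (s≤s (pigeonhole U (L ─ e∈L) f inj (λ i p → ∈-─ (into i p) (≢-sym (missed i p)) e∈L)))

  enumerate : ∀ {k} (U : Subset k) → Σ (List (Fin k)) λ L → length L ≡ ∣ U ∣ × (∀ i → i ∈ U → i ∈ₗ L)
  enumerate [] = [] , refl , λ i ()
  enumerate (outside ∷ U) with enumerate U
  ... | L , len , complete = map suc L , ≡.trans (List.length-map suc L) len , λ
    { (suc i) (there p) → ∈-map⁺ suc (complete i p) }
  enumerate (inside ∷ U) with enumerate U
  ... | L , len , complete = zero ∷ map suc L , cong suc (≡.trans (List.length-map suc L) len) , λ
    { zero here → here refl ; (suc i) (there p) → there (∈-map⁺ suc (complete i p)) }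

  subset-injection : ∀ {k} (U V : Subset k) (f : Fin k → Fin k) →
    InjectiveOn U f → (∀ i → i ∈ U → f i ∈ V) → ∣ U ∣ ≤ ∣ V ∣
  subset-injection U V f inj into with enumerate V
  ... | L , len , complete =
    subst (∣ U ∣ ≤_) len (pigeonhole U L f inj (λ i p → complete (f i) (into i p)))

  preimage : ∀ {k} → (Fin k → Fin k) → Subset k → Subset k
  preimage π S = tabulate (λ i → lookup S (π i))

  ∈-preimage⁻ : ∀ {k} (π : Fin k → Fin k) S i → i ∈ preimage π S → π i ∈ S
  ∈-preimage⁻ π S i p =
    Vec.lookup⇒[]= (π i) S (≡.trans (≡.sym (Vec.lookup∘tabulate _ i)) (Vec.[]=⇒lookup p))

  ∈-preimage⁺ : ∀ {k} (π : Fin k → Fin k) S i → π i ∈ S → i ∈ preimage π S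
  ∈-preimage⁺ π S i p =
    Vec.lookup⇒[]= i (preimage π S) (≡.trans (Vec.lookup∘tabulate _ i) (Vec.[]=⇒lookup p))

module Lemma41 {n k s′ t c : ℕ} (σ : Setting n k (suc s′) t c) where
  open Setting σ
  open Distances Γ
  open Descent Γ α
  open SubsetPigeonhole

  s : ℕ
  s = suc s′

  β-sphere : ∀ i → Sphere Γ α 1 (β i)
  β-sphere i = sphere-one (β-adj i)

  short-cycle : ∀ {L m} → suc L ≤ 2 * m → suc m ≤ s → 2 * s + 2 ≤ 3 + L → ⊥
  short-cycle {L} {m} len m<s cyc = <-irrefl (+-comm (2 * s) 2) (begin-strict
    2 * s + 2  ≤⟨ cyc ⟩
    2 + suc L  ≤⟨ +-monoʳ-≤ 2 len ⟩
    2 + 2 * m  <⟨ +-monoʳ-< 2 (*-monoʳ-< 2 m<s) ⟩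
    2 + 2 * s  ∎)
    where open ≤-Reasoning

  unique-branch : ∀ {m i i′ x} → suc m ≤ s → Sphere Γ (β i) m x → Sphere Γ (β i′) m x →
                  Sphere Γ α (suc m) x → i ≡ i′
  unique-branch {m} {i} {i′} m<s x∈Γᵢ x∈Γᵢ′ x∈Γα with i Fin.≟ i′
  ... | yes i≡i′ = i≡i′
  ... | no i≢i′ with simple-path {q = m} (i≢i′ ∘ β-inj) (β-sphere i) (β-sphere i′)
                       (descending (β-sphere i) (proj₁ x∈Γᵢ) (proj₂ x∈Γα))
                       (descending (β-sphere i′) (proj₁ x∈Γᵢ′) (proj₂ x∈Γα))
  ...   | M , linked , unique , far , len =
      ⊥-elim (short-cycle len m<s
        (subst (2 * s + 2 ≤_) (cong (λ ℓ → suc (suc ℓ)) (length-snoc M (β i′))) (proj₁ girth _ cycle)))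
    where
    cycle : CycleThrough Γ α (length (α ∷ β i ∷ M ++ [ β i′ ]))
    cycle = (β i ∷ M ++ [ β i′ ]) , refl ,
            subst (λ ℓ → 3 ≤ suc (suc ℓ)) (≡.sym (length-snoc M (β i′))) (s≤s (s≤s (s≤s z≤n))) ,
            (All.map (far-≢ (sphere-zero α)) far ∷ unique) ,
            (β-adj i ∷ linked-snoc (β i) M (β i′) α linked (~-sym (β-adj i′)))

  predecessor : ∀ {i δ} → Sphere Γ (β i) s δ → Sphere Γ α (suc s) δ → ∃[ x ] (δ ~ x × Bj σ i x)
  predecessor {i} (w , far) (_ , farα) with unsnoc w
  ... | x , w′ , x~δ = x , ~-sym x~δ , (step (β-adj i) w′ , far-snoc x~δ farα) , (w′ , far-snoc x~δ far)

  successor : ∀ {j x δ} → Sphere Γ (β j) s′ x → x ~ δ → Sphere Γ α (suc s) δ → Sphere Γ (β j) s δ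
  successor {j} (w , _) x~δ (_ , farα) = snoc w x~δ , far-step (β-adj j) farα

  module Predecessors {δ : Fin n} (δ∈Δ : Δ δ) (U : Subset k)
                      (U-dist : ∀ i → i ∈ U → Sphere Γ (β i) s δ) where

    prev : Fin k → Fin n
    prev i with i ∈? U
    ... | yes i∈U = proj₁ (predecessor (U-dist i i∈U) (Δ⊆ δ δ∈Δ))
    ... | no _ = δ

    prev-spec : ∀ i → i ∈ U → δ ~ prev i × Bj σ i (prev i)
    prev-spec i i∈U with i ∈? U
    ... | yes i∈U′ = proj₂ (predecessor (U-dist i i∈U′) (Δ⊆ δ δ∈Δ))
    ... | no i∉U = ⊥-elim (i∉U i∈U)

    branch-of-prev : ∀ {i j y} → i ∈ U → Sphere Γ (β j) s′ y → y ≡ prev i → j ≡ i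
    branch-of-prev {i} i∈U y∈Γⱼ refl with prev-spec i i∈U
    ... | _ , prev∈Γα , prev∈Γᵢ = unique-branch ≤-refl y∈Γⱼ prev∈Γᵢ prev∈Γα

    neighbours : List (Fin n)
    neighbours = proj₁ (cs′ δ δ∈Δ)

    neighbours-count : length neighbours ≡ c
    neighbours-count = proj₂ (proj₂ (proj₂ (cs′ δ δ∈Δ)))

    ∈-neighbours : ∀ {y} → δ ~ y → Sphere Γ α s y → y ∈ₗ neighbours
    ∈-neighbours δ~y y∈Γα = Equivalence.from (proj₁ (proj₂ (proj₂ (cs′ δ δ∈Δ))) _) (δ~y , y∈Γα)

    prev-injective : InjectiveOn U prev
    prev-injective i j i∈U j∈U e = branch-of-prev j∈U (proj₂ (proj₂ (prev-spec i i∈U))) e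

    prev-into : ∀ i → i ∈ U → prev i ∈ₗ neighbours
    prev-into i i∈U = ∈-neighbours (proj₁ (prev-spec i i∈U)) (proj₁ (proj₂ (prev-spec i i∈U)))

    index-set-bound : ∣ U ∣ ≤ c
    index-set-bound =
      subst (∣ U ∣ ≤_) neighbours-count (pigeonhole U neighbours prev prev-injective prev-into)

    no-missed-neighbour : ∣ U ∣ ≡ c → ∀ {y} → δ ~ y → Sphere Γ α s y → ¬ (∀ i → i ∈ U → y ≢ prev i)
    no-missed-neighbour U≡c δ~y y∈Γα y∉prev = 1+n≰n (subst (λ m → suc m ≤ c) U≡c
      (subst (suc ∣ U ∣ ≤_) neighbours-count
        (pigeonhole-strict U neighbours prev prev-injective prev-into _ (∈-neighbours δ~y y∈Γα) y∉prev)))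

    full-size-complete : ∣ U ∣ ≡ c → ∀ {j y} → δ ~ y → Bj σ j y → j ∈ U
    full-size-complete U≡c {j} δ~y (y∈Γα , y∈Γⱼ) with j ∈? U
    ... | yes j∈U = j∈U
    ... | no j∉U = ⊥-elim (no-missed-neighbour U≡c δ~y y∈Γα λ i i∈U y≡i →
          j∉U (subst (_∈ U) (≡.sym (branch-of-prev i∈U y∈Γⱼ y≡i)) i∈U))

    full-size-predecessor : ∣ U ∣ ≡ c → ∀ {j y} → δ ~ y → Bj σ j y → y ≡ prev j
    full-size-predecessor U≡c {j} {y} δ~y (y∈Γα , y∈Γⱼ) with y Fin.≟ prev j
    ... | yes y≡prev = y≡prev
    ... | no y≢prev = ⊥-elim (no-missed-neighbour U≡c δ~y y∈Γα λ i i∈U y≡i →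
          y≢prev (≡.trans y≡i (cong prev (≡.sym (branch-of-prev i∈U y∈Γⱼ y≡i)))))

  full-index-set-complete : ∀ {S δ j} → ∣ S ∣ ≡ c → ΔS σ S δ → Sphere Γ (β j) s δ → j ∈ S
  full-index-set-complete {S} {δ} S≡c (δ∈Δ , S-dist) δ∈Γⱼ with predecessor δ∈Γⱼ (Δ⊆ δ δ∈Δ)
  ... | x , δ~x , x∈Bⱼ = full-size-complete S≡c δ~x x∈Bⱼ
    where open Predecessors δ∈Δ S S-dist

  full-index-set-unique : ∀ {S S′ δ} → ∣ S ∣ ≡ c → ∣ S′ ∣ ≡ c → ΔS σ S δ → ΔS σ S′ δ → S ≡ S′
  full-index-set-unique S≡c S′≡c δ∈ΔS δ∈ΔS′ =
    ⊆-antisym (λ {i} i∈S → full-index-set-complete S′≡c δ∈ΔS′ (proj₂ δ∈ΔS i i∈S))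
              (λ {i} i∈S′ → full-index-set-complete S≡c δ∈ΔS (proj₂ δ∈ΔS′ i i∈S′))

  unique-predecessor : ∀ {S δ j x x′} → ∣ S ∣ ≡ c → ΔS σ S δ →
                       δ ~ x → Bj σ j x → δ ~ x′ → Bj σ j x′ → x ≡ x′
  unique-predecessor {S} S≡c (δ∈Δ , S-dist) δ~x x∈Bⱼ δ~x′ x′∈Bⱼ =
    ≡.trans (full-size-predecessor S≡c δ~x x∈Bⱼ) (≡.sym (full-size-predecessor S≡c δ~x′ x′∈Bⱼ))
    where open Predecessors δ∈Δ S S-dist

  orbit-connect : ∀ {δ₁ δ} → Δ δ₁ → Δ δ →
    ∃[ h ] (Mem G h × Inverse.to h α ≡ α × Inverse.to h δ₁ ≡ δ)
  orbit-connect {δ₁} {δ} δ₁∈Δ δ∈Δ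
    with Equivalence.to (orbit δ₁) δ₁∈Δ | Equivalence.to (orbit δ) δ∈Δ
  ... | g₁ , g₁∈G , g₁α , g₁δ₀ | g₂ , g₂∈G , g₂α , g₂δ₀ =
      g₂ ↔-∘ ↔-sym g₁ , comp∈ G g₂ (↔-sym g₁) g₂∈G (inv∈ G g₁ g₁∈G) ,
      ≡.trans (cong (Inverse.to g₂) (from-fixed α g₁α)) g₂α ,
      ≡.trans (cong (Inverse.to g₂) (from-fixed δ₀ g₁δ₀)) g₂δ₀
    where
    from-fixed : ∀ x {y} → Inverse.to g₁ x ≡ y → Inverse.from g₁ y ≡ x
    from-fixed x refl = Inverse.strictlyInverseʳ g₁ x

  relabel : ∀ g → IsAut Γ g → Inverse.to g α ≡ α → ∀ i → ∃[ i′ ] β i′ ≡ Inverse.to g (β i)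
  relabel g g-aut gα i = β-onto _ (subst (_~ Inverse.to g (β i)) gα (aut-adj (β-adj i)))
    where open Automorphism g g-aut

  -- Δ being a G_α-orbit, an index set of size c at one vertex of Δ moves to
  -- every vertex of Δ: take the preimage of S under the induced relabelling
  full-index-set : ∀ {S δ₁ δ} → ∣ S ∣ ≡ c → ΔS σ S δ₁ → Δ δ → ∃[ S′ ] (∣ S′ ∣ ≡ c × ΔS σ S′ δ)
  full-index-set {S} {δ = δ} S≡c (δ₁∈Δ , S-dist) δ∈Δ with orbit-connect δ₁∈Δ δ∈Δ
  ... | h , h∈G , hα , hδ₁ = S′ , ≤-antisym (index-set-bound) (subst (_≤ ∣ S′ ∣) S≡c S≤S′) , δ∈ΔS′
    where
    open Inverse h using (to; from; strictlyInverseˡ; strictlyInverseʳ)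
    h⁻¹α : from α ≡ α
    h⁻¹α = ≡.trans (cong from (≡.sym hα)) (strictlyInverseʳ α)
    relabel-h : ∀ i → ∃[ i′ ] β i′ ≡ to (β i)
    relabel-h = relabel h (aut G h h∈G) hα
    relabel-h⁻¹ : ∀ i → ∃[ i′ ] β i′ ≡ from (β i)
    relabel-h⁻¹ = relabel (↔-sym h) (aut G (↔-sym h) (inv∈ G h h∈G)) h⁻¹α
    π π⁻¹ : Fin k → Fin k
    π = proj₁ ∘ relabel-h
    π⁻¹ = proj₁ ∘ relabel-h⁻¹
    S′ : Subset k
    S′ = preimage π⁻¹ S
    S′-dist : ∀ i → i ∈ S′ → Sphere Γ (β i) s δ
    S′-dist i i∈S′ = subst₂ (λ b d → Sphere Γ b s d)
      (≡.trans (cong to (proj₂ (relabel-h⁻¹ i))) (strictlyInverseˡ (β i))) hδ₁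
      (Automorphism.aut-sphere h (aut G h h∈G) (S-dist (π⁻¹ i) (∈-preimage⁻ π⁻¹ S i i∈S′)))
    δ∈ΔS′ : ΔS σ S′ δ
    δ∈ΔS′ = δ∈Δ , S′-dist
    open Predecessors δ∈Δ S′ S′-dist using (index-set-bound)
    π⁻¹∘π : ∀ i → π⁻¹ (π i) ≡ i
    π⁻¹∘π i = β-inj (≡.trans (proj₂ (relabel-h⁻¹ (π i)))
      (≡.trans (cong from (proj₂ (relabel-h i))) (strictlyInverseʳ (β i))))
    π-injective : ∀ i j → π i ≡ π j → i ≡ j
    π-injective i j e = ≡.trans (≡.sym (π⁻¹∘π i)) (≡.trans (cong π⁻¹ e) (π⁻¹∘π j))
    S≤S′ : ∣ S ∣ ≤ ∣ S′ ∣
    S≤S′ = subset-injection S S′ π (λ i j _ _ → π-injective i j)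
      (λ i i∈S → ∈-preimage⁺ π⁻¹ S (π i) (subst (_∈ S) (≡.sym (π⁻¹∘π i)) i∈S))

  Covered : Set
  Covered = ∀ {δ} → Δ δ → ∃[ S′ ] (∣ S′ ∣ ≡ c × ΔS σ S′ δ)

  Index : Fin k → Subset k → Set
  Index j S′ = 𝓑 σ S′ × j ∈ S′

  _≟ˢ_ : DecidableEquality (Subset k)
  _≟ˢ_ = Vec.≡-dec Bool._≟_

  -- part 1: B_j ⊆ Γ_s(α) and Δ ⊆ Γ_{s+1}(α), so a shared endpoint is either in
  -- B_j (then b_s' = 1 identifies the Δ-ends) or in Δ (then δ has one
  -- neighbour in B_j)
  matching-Bⱼ-Δⱼ : bs′≡ σ 1 → Covered → ∀ j → IsMatching Γ (Bj σ j) (Δj σ j)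
  matching-Bⱼ-Δⱼ bs covered j x y x′ y′ x∈Bⱼ@(x∈Γα , _) (y∈Δ , _) x~y x′∈Bⱼ@(x′∈Γα , _) (y′∈Δ , _) x′~y′ =
    shared
    where
    levels-differ : ∀ {z} → Sphere Γ α s z → Δ z → ⊥
    levels-differ z∈Γα z∈Δ = 1+n≰n (≤-reflexive (dist-unique (Δ⊆ _ z∈Δ) z∈Γα))
    shared : (x ≡ x′ ⊎ x ≡ y′ ⊎ y ≡ x′ ⊎ y ≡ y′) → (x ≡ x′ × y ≡ y′) ⊎ (x ≡ y′ × y ≡ x′)
    shared (inj₁ refl) = inj₁ (refl , size-one-unique (bs x x∈Γα) (x~y , y∈Δ) (x′~y′ , y′∈Δ))
    shared (inj₂ (inj₁ refl)) = ⊥-elim (levels-differ x∈Γα y′∈Δ)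
    shared (inj₂ (inj₂ (inj₁ refl))) = ⊥-elim (levels-differ x′∈Γα y∈Δ)
    shared (inj₂ (inj₂ (inj₂ refl))) with covered y∈Δ
    ... | S′ , S′≡c , y∈ΔS′ =
          inj₁ (unique-predecessor S′≡c y∈ΔS′ (~-sym x~y) x∈Bⱼ (~-sym x′~y′) x′∈Bⱼ , refl)

  -- part 2 restricts part 1, as B_j(S) ⊆ B_j and Δ(S) ⊆ Δ_j for j ∈ S
  matching-Bⱼ⟨S⟩-Δ⟨S⟩ : bs′≡ σ 1 → Covered → ∀ j S → j ∈ S → IsMatching Γ (BjS σ j S) (ΔS σ S)
  matching-Bⱼ⟨S⟩-Δ⟨S⟩ bs covered j S j∈S = matching-mono (matching-Bⱼ-Δⱼ bs covered j)
    (λ _ (_ , _ , x∈Bⱼ , _) → x∈Bⱼ) (λ _ (y∈Δ , S-dist) → y∈Δ , S-dist j j∈S)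

  -- part 3: y ∈ B_j lies in B_j(S′) exactly for the index set S′ of its unique
  -- neighbour in Δ
  partition-Bⱼ : bs′≡ σ 1 → Covered → ∀ j → IsPartition (Index j) (BjS σ j) (Bj σ j)
  partition-Bⱼ bs covered j = nonempty , equal-or-disjoint _≟ˢ_ (Index j) (BjS σ j) meet , covers
    where
    nonempty : ∀ S′ → Index j S′ → ∃[ y ] BjS σ j S′ y
    nonempty S′ ((_ , δ , δ∈ΔS′) , j∈S′) with predecessor (proj₂ δ∈ΔS′ j j∈S′) (Δ⊆ δ (proj₁ δ∈ΔS′))
    ... | x , δ~x , x∈Bⱼ = x , δ , δ∈ΔS′ , x∈Bⱼ , δ~x

    meet : ∀ S′ S″ y → Index j S′ → Index j S″ → BjS σ j S′ y → BjS σ j S″ y → S′ ≡ S″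
    meet S′ S″ y ((S′≡c , _) , _) ((S″≡c , _) , _) (δ′ , δ′∈ΔS′ , (y∈Γα , _) , δ′~y) (δ″ , δ″∈ΔS″ , _ , δ″~y) =
      full-index-set-unique S′≡c S″≡c δ′∈ΔS′ (subst (ΔS σ S″) (≡.sym δ′≡δ″) δ″∈ΔS″)
      where
      δ′≡δ″ : δ′ ≡ δ″
      δ′≡δ″ = size-one-unique (bs y y∈Γα) (~-sym δ′~y , proj₁ δ′∈ΔS′) (~-sym δ″~y , proj₁ δ″∈ΔS″)

    index-of : ∀ {y} → Bj σ j y → ∃[ S′ ] (Index j S′ × BjS σ j S′ y)
    index-of {y} y∈Bⱼ@(y∈Γα , y∈Γⱼ) with size-one-witness (bs y y∈Γα)
    ... | δ , y~δ , δ∈Δ with covered δ∈Δ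
    ...   | S′ , S′≡c , δ∈ΔS′ =
          S′ , ((S′≡c , δ , δ∈ΔS′) , full-index-set-complete S′≡c δ∈ΔS′ (successor y∈Γⱼ y~δ (Δ⊆ δ δ∈Δ))) ,
          (δ , δ∈ΔS′ , y∈Bⱼ , ~-sym y~δ)

    covers : ∀ y → Bj σ j y ⇔ (∃[ S′ ] (Index j S′ × BjS σ j S′ y))
    covers y = mk⇔ index-of (λ (_ , _ , _ , _ , y∈Bⱼ , _) → y∈Bⱼ)

  -- part 4: δ ∈ Δ_j lies in Δ(S′) exactly for its full index set S′, which contains j
  partition-Δⱼ : Covered → ∀ j → IsPartition (Index j) (ΔS σ) (Δj σ j)
  partition-Δⱼ covered j = nonempty , equal-or-disjoint _≟ˢ_ (Index j) (ΔS σ) meet , covers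
    where
    nonempty : ∀ S′ → Index j S′ → ∃[ δ ] ΔS σ S′ δ
    nonempty S′ ((_ , δ∈ΔS′) , _) = δ∈ΔS′

    meet : ∀ S′ S″ δ → Index j S′ → Index j S″ → ΔS σ S′ δ → ΔS σ S″ δ → S′ ≡ S″
    meet S′ S″ δ ((S′≡c , _) , _) ((S″≡c , _) , _) = full-index-set-unique S′≡c S″≡c

    index-of : ∀ {δ} → Δj σ j δ → ∃[ S′ ] (Index j S′ × ΔS σ S′ δ)
    index-of {δ} (δ∈Δ , δ∈Γⱼ) with covered δ∈Δ
    ... | S′ , S′≡c , δ∈ΔS′ = S′ , ((S′≡c , δ , δ∈ΔS′) , full-index-set-complete S′≡c δ∈ΔS′ δ∈Γⱼ) , δ∈ΔS′

    covers : ∀ δ → Δj σ j δ ⇔ (∃[ S′ ] (Index j S′ × ΔS σ S′ δ))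
    covers δ = mk⇔ index-of (λ (_ , (_ , j∈S′) , δ∈Δ , S′-dist) → δ∈Δ , S′-dist j j∈S′)

lemma4p1 : ∀ {n k s t c : ℕ} (σ : Setting n k s t c) → bs′≡ σ 1 →
    ∀ (j : Fin k) (S : Subset k) → 𝓑 σ S → j ∈ S →
    IsMatching (Setting.Γ σ) (Bj σ j) (Δj σ j) ×
    IsMatching (Setting.Γ σ) (BjS σ j S) (ΔS σ S) ×
    IsPartition (λ S′ → 𝓑 σ S′ × j ∈ S′) (BjS σ j) (Bj σ j) ×
    IsPartition (λ S′ → 𝓑 σ S′ × j ∈ S′) (ΔS σ) (Δj σ j)
lemma4p1 {s = zero} σ with Setting.s≥1 σ
... | ()
lemma4p1 {s = suc _} σ bs j S (S≡c , δ₁ , δ₁∈ΔS) j∈S =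
  matching-Bⱼ-Δⱼ bs covered j , matching-Bⱼ⟨S⟩-Δ⟨S⟩ bs covered j S j∈S ,
  partition-Bⱼ bs covered j , partition-Δⱼ covered j
  where
  open Lemma41 σ
  covered : Covered
  covered = full-index-set S≡c δ₁∈ΔS
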